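{- There are infinitely many positive integers $N$ for which there is no representation $N = A/B$ with $A, B$ antipalindromic numbers.
   Context: A positive integer is antipalindromic if its base-$2$ representation (without leading zeros) $w_1 \cdots w_{2m}$ has even length and satisfies $w_i + w_{2m+1-i} = 1$ for all $i$ (the second half is the reverse complement of the first half). -}

module Defs where

open import Data.Nat using (ℕ; zero; suc; _+_; _*_; _<_; _/_; _%_)
open import Data.Bool using (Bool; true; false; not)
open import Data.List using (List; []; _∷_; reverse; map; length)
open import Data.Product using (_×_; ∃)
open import Relation.Binary.PropositionalEquality using (_≡_)

-- Least-significant-first binary digits of n, computed with fuel
-- (fuel ≥ n suffices, since each step at least halves a positive number).
bitsLSB-fuel : ℕ → ℕ → List Bool
bitsLSB-fuel zero    _ = []
bitsLSB-fuel (suc f) zero = []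
bitsLSB-fuel (suc f) n@(suc _) with n % 2
... | zero  = false ∷ bitsLSB-fuel f (n / 2)
... | suc _ = true  ∷ bitsLSB-fuel f (n / 2)

-- Base-2 representation of n without leading zeros, most significant digit first
-- (true = 1, false = 0); the representation of 0 is the empty list.
binary : ℕ → List Bool
binary n = reverse (bitsLSB-fuel n n)

-- The digit word w₁ ⋯ w₂ₘ is antipalindromic: even length and
-- w_i + w_{2m+1-i} = 1 for all i, i.e. w equals its reversed complement.
AntipalWord : List Bool → Set
AntipalWord w = (∃ λ m → length w ≡ m + m) × (w ≡ map not (reverse w))

Antipalindromic : ℕ → Set
Antipalindromic n = (0 < n) × AntipalWord (binary n)

-- Doubling a positive number appends a 0 to its binary word, so multiplying by
-- 2 ^ j adds exactly j to the length. Antipalindromic numbers have binary words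
-- of even length, hence A = 2 ^ (2k+1) * B is impossible for antipalindromic A, B
-- by parity, and the numbers 2 ^ (2k+1) form the required infinite family.
module Submission where

open import Defs
open import Data.Nat using (ℕ; zero; suc; _+_; _*_; _^_; _<_; _≤_; _/_; _%_; z≤n; s≤s)
open import Data.Nat.Properties
open import Data.Nat.DivMod using (m*n%n≡0; m*n/n≡m; m/n<m)
open import Data.List using (_∷_; _∷ʳ_; length; reverse)
open import Data.List.Properties using (unfold-reverse; length-++)
open import Data.Bool using (false)
open import Data.Product using (_×_; ∃-syntax; _,_)
open import Relation.Binary.PropositionalEquality
open import Relation.Nullary using (¬_)
open import Algebra.Properties.CommutativeSemigroup +-commutativeSemigroup using (interchange)

bitsLSB-fuel-irrelevant : ∀ {f f′} n → n ≤ f → n ≤ f′ → bitsLSB-fuel f n ≡ bitsLSB-fuel f′ n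
bitsLSB-fuel-irrelevant {zero}  {zero}   zero _ _ = refl
bitsLSB-fuel-irrelevant {zero}  {suc _}  zero _ _ = refl
bitsLSB-fuel-irrelevant {suc _} {zero}   zero _ _ = refl
bitsLSB-fuel-irrelevant {suc _} {suc _}  zero _ _ = refl
bitsLSB-fuel-irrelevant {suc f} {suc f′} n@(suc _) (s≤s n≤1+f) (s≤s n≤1+f′)
  with n % 2 | bitsLSB-fuel-irrelevant {f} {f′} (n / 2) (≤-trans n/2≤n-1 n≤1+f) (≤-trans n/2≤n-1 n≤1+f′)
  where
  n/2≤n-1 : n / 2 ≤ _
  n/2≤n-1 = ≤-pred (m/n<m n 2 (s≤s (s≤s z≤n)))
... | zero  | rest = cong (false ∷_) rest
... | suc _ | rest = cong (_ ∷_) rest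

bitsLSB-fuel-even : ∀ f n → suc n % 2 ≡ 0 → bitsLSB-fuel (suc f) (suc n) ≡ false ∷ bitsLSB-fuel f (suc n / 2)
bitsLSB-fuel-even f n even with suc n % 2 | even
... | zero | _ = refl

binary-*2 : ∀ n → binary (suc n * 2) ≡ binary (suc n) ∷ʳ false
binary-*2 n = begin
  reverse (bitsLSB-fuel (suc n * 2) (suc n * 2))
    ≡⟨ cong reverse (bitsLSB-fuel-even (suc (n * 2)) (suc (n * 2)) (m*n%n≡0 (suc n) 2)) ⟩
  reverse (false ∷ bitsLSB-fuel (suc (n * 2)) (suc n * 2 / 2))
    ≡⟨ cong (λ m → reverse (false ∷ bitsLSB-fuel (suc (n * 2)) m)) (m*n/n≡m (suc n) 2) ⟩
  reverse (false ∷ bitsLSB-fuel (suc (n * 2)) (suc n))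
    ≡⟨ cong (λ bs → reverse (false ∷ bs)) (bitsLSB-fuel-irrelevant (suc n) 1+n≤fuel ≤-refl) ⟩
  reverse (false ∷ bitsLSB-fuel (suc n) (suc n))
    ≡⟨ unfold-reverse false (bitsLSB-fuel (suc n) (suc n)) ⟩
  binary (suc n) ∷ʳ false
    ∎
  where
  open ≡-Reasoning
  1+n≤fuel : suc n ≤ suc (n * 2)
  1+n≤fuel = s≤s (m≤m*n n 2)

length-binary-*2 : ∀ n → 0 < n → length (binary (n * 2)) ≡ suc (length (binary n))
length-binary-*2 (suc n) _ = begin
  length (binary (suc n * 2))           ≡⟨ cong length (binary-*2 n) ⟩
  length (binary (suc n) ∷ʳ false)      ≡⟨ length-++ (binary (suc n)) ⟩
  length (binary (suc n)) + 1           ≡⟨ +-comm _ 1 ⟩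
  suc (length (binary (suc n)))         ∎
  where open ≡-Reasoning

length-binary-2^* : ∀ j n → 0 < n → length (binary (2 ^ j * n)) ≡ j + length (binary n)
length-binary-2^* zero    n _   = cong (λ m → length (binary m)) (+-identityʳ n)
length-binary-2^* (suc j) n 0<n = begin
  length (binary (2 * 2 ^ j * n))       ≡⟨ cong (λ m → length (binary m)) reassoc ⟩
  length (binary (2 ^ j * n * 2))       ≡⟨ length-binary-*2 _ (*-mono-≤ (m^n>0 2 j) 0<n) ⟩
  suc (length (binary (2 ^ j * n)))     ≡⟨ cong suc (length-binary-2^* j n 0<n) ⟩
  suc (j + length (binary n))           ∎
  where
  open ≡-Reasoning
  reassoc : 2 * 2 ^ j * n ≡ 2 ^ j * n * 2
  reassoc = trans (*-assoc 2 (2 ^ j) n) (*-comm 2 (2 ^ j * n))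

antipalindromic-≢-2^odd* : ∀ k {A B} → Antipalindromic A → Antipalindromic B → A ≢ 2 ^ suc (k + k) * B
antipalindromic-≢-2^odd* k {A} {B} (_ , (a , |A|≡a+a) , _) (0<B , (b , |B|≡b+b) , _) A≡2^oddB =
  even≢odd a (k + b) (begin
    2 * a                                  ≡⟨ cong (a +_) (+-identityʳ a) ⟩
    a + a                                  ≡⟨ sym |A|≡a+a ⟩
    length (binary A)                      ≡⟨ cong (λ m → length (binary m)) A≡2^oddB ⟩
    length (binary (2 ^ suc (k + k) * B))  ≡⟨ length-binary-2^* (suc (k + k)) B 0<B ⟩
    suc (k + k + length (binary B))        ≡⟨ cong (λ l → suc (k + k + l)) |B|≡b+b ⟩
    suc (k + k + (b + b))                  ≡⟨ cong suc (interchange k k b b) ⟩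
    suc (k + b + (k + b))                  ≡⟨ cong (λ c → suc (k + b + c)) (sym (+-identityʳ (k + b))) ⟩
    suc (2 * (k + b))                      ∎)
  where open ≡-Reasoning

n<2^n : ∀ n → n < 2 ^ n
n<2^n zero    = s≤s z≤n
n<2^n (suc n) = +-mono-≤ (m^n>0 2 n) (≤-trans (n<2^n n) (m≤m+n (2 ^ n) 0))

theorem18 : ∀ (k : ℕ) → ∃[ N ] (k < N × ¬ (∃[ A ] ∃[ B ] (Antipalindromic A × Antipalindromic B × A ≡ N * B)))
theorem18 k =
  2 ^ suc (k + k) ,
  <-trans (s≤s (m≤m+n k k)) (n<2^n (suc (k + k))) ,
  λ (A , B , antipalA , antipalB , A≡NB) → antipalindromic-≢-2^odd* k antipalA antipalB A≡NB
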